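{- For all integers $1\le k\le n$ and every $\pi\in\Pi(n)$, \[ |S^{M}_{\mathrm{out}}(\pi;k)\cap S^{M}_{\mathrm{in}}(\pi;k)| = (n-k+1)(k-1)+1. \]
   Context: $\Pi(n)$ denotes the set of permutations of $\{1,\dots,n\}$, each regarded as a sequence $\pi=(\pi_1,\dots,\pi_n)$. A mirror TDRL (MTDRL) operation on a sequence $(x_1,\dots,x_m)$ of distinct symbols is specified by $b\in\{0,1\}^m$. Its result is the concatenation of $(x_i:b_i=1)$, with indices in increasing order, followed by $(x_i:b_i=0)$, with indices in decreasing order. A bounded MTDRL operation of width $k$ on $\pi\in\Pi(n)$ proceeds as follows: choose $j$ with $1\le j\le n-k+1$, apply an MTDRL operation to the segment $(\pi_j,\dots,\pi_{j+k-1})$, and replace this segment by the result, leaving all other entries in place. $S^{M}_{\mathrm{out}}(\pi;k)$ is the set of all permutations obtainable from $\pi$ by one bounded MTDRL operation of width $k$. $S^{M}_{\mathrm{in}}(\pi;k)=\{\rho\in\Pi(n):\pi\in S^{M}_{\mathrm{out}}(\rho;k)\}$. -}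

module Defs where

open import Data.Nat using (ℕ; suc; _+_; _∸_; _≤_)
open import Data.Bool using (Bool; true; false; not)
open import Data.List using (List; []; _∷_; _++_; reverse; take; drop; upTo; map; length)
open import Data.Vec using (Vec; []; _∷_)
open import Data.Product using (Σ; _×_; ∃)
open import Relation.Binary.PropositionalEquality using (_≡_)
open import Data.List.Relation.Binary.Permutation.Propositional using (_↭_)
open import Data.List.Relation.Unary.Unique.Propositional using (Unique)
open import Data.List.Membership.Propositional using (_∈_)
open import Function.Bundles using (_⇔_)

IsPerm : ℕ → List ℕ → Set
IsPerm n ρ = ρ ↭ map suc (upTo n)

ones : ∀ {A : Set} {m} → Vec Bool m → List A → List A
ones [] _ = []
ones (_ ∷ _) [] = []
ones (true ∷ b) (x ∷ xs) = x ∷ ones b xs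
ones (false ∷ b) (x ∷ xs) = ones b xs

zeros : ∀ {A : Set} {m} → Vec Bool m → List A → List A
zeros [] _ = []
zeros (_ ∷ _) [] = []
zeros (true ∷ b) (x ∷ xs) = zeros b xs
zeros (false ∷ b) (x ∷ xs) = x ∷ zeros b xs

mtdrl : ∀ {A : Set} {m} → Vec Bool m → List A → List A
mtdrl b xs = ones b xs ++ reverse (zeros b xs)

-- bounded MTDRL operation of width k at (1-based) position j
boundedMTDRL : ∀ {k} → ℕ → Vec Bool k → List ℕ → List ℕ
boundedMTDRL {k} j b π =
  take (j ∸ 1) π ++ mtdrl b (take k (drop (j ∸ 1) π)) ++ drop (j ∸ 1 + k) π

Sout : ℕ → ℕ → List ℕ → List ℕ → Set
Sout n k π ρ = Σ ℕ λ j → (1 ≤ j) × (j ≤ n ∸ k + 1) ×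
                 Σ (Vec Bool k) λ b → ρ ≡ boundedMTDRL j b π

Sin : ℕ → ℕ → List ℕ → List ℕ → Set
Sin n k π ρ = IsPerm n ρ × Sout n k ρ π

HasCard : (List ℕ → Set) → ℕ → Set
HasCard P c = Σ (List (List ℕ)) λ L →
  Unique L × (∀ ρ → (ρ ∈ L) ⇔ P ρ) × length L ≡ c

module Submission where

-- A permutation ρ lies in
-- S_out(π;k) ∩ S_in(π;k) exactly when ρ = π or ρ is obtained from π by
-- reversing the last t ∈ {2,…,k} entries of one of the n ∸ k + 1 windows of
-- width k; these (n ∸ k + 1)(k ∸ 1) suffix reversals are pairwise distinct and
-- different from π, which gives the count.
--
-- Two invariants locate changes: the length of the
-- common suffix of π and ρ pins down the window that was operated on, and
-- inside the window the length of the common prefix pins down the reversed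
-- suffix.

open import Defs
open import Data.Nat using (ℕ; zero; suc; _+_; _*_; _∸_; _⊓_; _≤_; _<_; z≤n; s≤s; s≤s⁻¹; _≤?_; _≟_)
open import Data.Nat.Properties
open import Data.Bool using (Bool; true; false)
open import Data.Empty using (⊥; ⊥-elim)
open import Data.List using (List; []; _∷_; _++_; reverse; take; drop; upTo; map; length; [_]; cartesianProduct)
open import Data.List.Properties using (++-assoc; ++-identityʳ; ++-cancelˡ; ++-cancelʳ; ∷-injective; ∷-injectiveˡ; ∷-injectiveʳ; unfold-reverse; reverse-++; reverse-involutive; length-reverse; length-++; length-map; length-upTo; length-take; length-drop; take++drop≡id; drop-drop)
open import Data.Vec using (Vec; []; _∷_)
open import Data.Product using (_×_; _,_; proj₁; proj₂; ∃; ∃₂)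
open import Data.Sum using (_⊎_; inj₁; inj₂)
open import Relation.Binary.PropositionalEquality hiding ([_])
open import Relation.Binary.PropositionalEquality.Properties using (setoid)
open import Relation.Nullary using (yes; no; does)
open import Relation.Nullary.Decidable using (dec-true; dec-false)
open import Function.Bundles using (mk⇔)
open import Data.List.Relation.Binary.Permutation.Propositional using (_↭_; ↭-sym; ↭-trans; ↭-refl; prep; ↭⇒↭ₛ)
open import Data.List.Relation.Binary.Permutation.Propositional.Properties using (↭-length; ∷↭∷ʳ; ++⁺ˡ; ++⁺ʳ)
open import Data.List.Relation.Binary.Permutation.Setoid.Properties using (Unique-resp-↭)
open import Data.List.Relation.Unary.Unique.Propositional using (Unique)
open import Data.List.Relation.Unary.AllPairs using ([]; _∷_)
open import Data.List.Relation.Unary.All as All using (All)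
open import Data.List.Relation.Unary.Any using (here; there)
open import Data.List.Membership.Propositional using (_∈_)
open import Data.List.Membership.Propositional.Properties using (∈-++⁺ʳ; ∈-map⁺; ∈-map⁻; ∈-cartesianProduct⁺; ∈-cartesianProduct⁻; ∈-upTo⁺; ∈-upTo⁻)
import Data.List.Relation.Unary.All.Properties as AllP
import Data.List.Relation.Unary.Any.Properties as AnyP
import Data.List.Relation.Unary.Unique.Propositional.Properties as UniqueP

open ≡-Reasoning

unique-↭ : ∀ {xs ys : List ℕ} → xs ↭ ys → Unique xs → Unique ys
unique-↭ p = Unique-resp-↭ (setoid ℕ) (↭⇒↭ₛ p)

IsPerm⇒length : ∀ {n ρ} → IsPerm n ρ → length ρ ≡ n
IsPerm⇒length {n} p = trans (↭-length p) (trans (length-map suc (upTo n)) (length-upTo n))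

IsPerm⇒Unique : ∀ {n ρ} → IsPerm n ρ → Unique ρ
IsPerm⇒Unique {n} p = unique-↭ (↭-sym p) (UniqueP.map⁺ suc-injective (UniqueP.upTo⁺ n))

take-length-++ : ∀ {A : Set} (xs ys : List A) → take (length xs) (xs ++ ys) ≡ xs
take-length-++ [] ys = refl
take-length-++ (x ∷ xs) ys = cong (x ∷_) (take-length-++ xs ys)

drop-length-++ : ∀ {A : Set} (xs ys : List A) → drop (length xs) (xs ++ ys) ≡ ys
drop-length-++ [] ys = refl
drop-length-++ (x ∷ xs) ys = drop-length-++ xs ys

++-cancel-middle : ∀ (A X Y C : List ℕ) → A ++ X ++ C ≡ A ++ Y ++ C → X ≡ Y
++-cancel-middle A X Y C eq = ++-cancelʳ C X Y (++-cancelˡ A (X ++ C) (Y ++ C) eq)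

head-of-snoc : ∀ (ys : List ℕ) {z x R} → ys ++ [ z ] ≡ x ∷ R → (z ≡ x) ⊎ ∃ λ W → ys ≡ x ∷ W
head-of-snoc [] eq = inj₁ (∷-injectiveˡ eq)
head-of-snoc (y ∷ W) eq = inj₂ (W , cong (_∷ W) (∷-injectiveˡ eq))

snoc≡cons : ∀ (U : List ℕ) {x X} → U ++ [ x ] ≡ x ∷ X → (X ≡ []) ⊎ (x ∈ X)
snoc≡cons [] refl = inj₁ refl
snoc≡cons (u ∷ U) {x} eq with ∷-injective eq
... | refl , U++x≡X = inj₂ (subst (x ∈_) U++x≡X (∈-++⁺ʳ U (here refl)))

length-cartesianProduct : ∀ {A B : Set} (xs : List A) (ys : List B) →
  length (cartesianProduct xs ys) ≡ length xs * length ys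
length-cartesianProduct [] ys = refl
length-cartesianProduct (x ∷ xs) ys = begin
  length (map (x ,_) ys ++ cartesianProduct xs ys)       ≡⟨ length-++ (map (x ,_) ys) ⟩
  length (map (x ,_) ys) + length (cartesianProduct xs ys) ≡⟨ cong₂ _+_ (length-map (x ,_) ys) (length-cartesianProduct xs ys) ⟩
  length ys + length xs * length ys                       ∎

map-Unique-on : ∀ {A B : Set} (f : A → B) {xs : List A} →
  (∀ {x y} → x ∈ xs → y ∈ xs → f x ≡ f y → x ≡ y) → Unique xs → Unique (map f xs)
map-Unique-on f inj [] = []
map-Unique-on f inj (x∉ ∷ u) =
  AllP.map⁺ (All.tabulate λ y∈ fx≡fy → All.lookup x∉ y∈ (inj (here refl) (there y∈) fx≡fy))
  ∷ map-Unique-on f (λ x∈ y∈ → inj (there x∈) (there y∈)) u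

HeadsDiffer : List ℕ → List ℕ → Set
HeadsDiffer (x ∷ _) (y ∷ _) = x ≢ y
HeadsDiffer _ _ = ⊥

HeadsDiffer-++ : ∀ {xs ys} r r' → HeadsDiffer xs ys → HeadsDiffer (xs ++ r) (ys ++ r')
HeadsDiffer-++ {_ ∷ _} {_ ∷ _} r r' d = d

HeadsDiffer-sym : ∀ {xs ys} → HeadsDiffer xs ys → HeadsDiffer ys xs
HeadsDiffer-sym {_ ∷ _} {_ ∷ _} d = λ y≡x → d (sym y≡x)

HeadsDiffer⇒≢ : ∀ {xs ys} → HeadsDiffer xs ys → xs ≢ ys
HeadsDiffer⇒≢ {_ ∷ _} {_ ∷ _} d refl = d refl

last≢ : ∀ {u} z Z → All (u ≢_) (z ∷ Z) → HeadsDiffer (reverse (z ∷ Z)) [ u ]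
last≢ z Z u∉ with reverse (z ∷ Z) in eq
... | [] = ⊥-elim (AnyP.¬Any[] (subst (z ∈_) eq (AnyP.reverse⁺ {xs = z ∷ Z} (here refl))))
... | w ∷ _ = λ w≡u → All.lookup u∉ (AnyP.reverse⁻ {xs = z ∷ Z} (subst (w ∈_) (sym eq) (here refl))) (sym w≡u)

last≢first : ∀ u z Z R → Unique (u ∷ z ∷ Z) → HeadsDiffer (reverse (u ∷ z ∷ Z)) (u ∷ R)
last≢first u z Z R (u∉ ∷ _) =
  subst (λ r → HeadsDiffer r (u ∷ R)) (sym (unfold-reverse u (z ∷ Z)))
    (HeadsDiffer-++ [ u ] R (last≢ z Z u∉))

ends-differ : ∀ S → Unique S → 2 ≤ length S → HeadsDiffer (reverse S) S
ends-differ (u ∷ z ∷ Z) S-unique _ = last≢first u z Z (z ∷ Z) S-unique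
ends-differ [] _ ()
ends-differ (_ ∷ []) _ (s≤s ())

commonPrefix : List ℕ → List ℕ → ℕ
commonPrefix [] _ = 0
commonPrefix (_ ∷ _) [] = 0
commonPrefix (x ∷ xs) (y ∷ ys) with x ≟ y
... | yes _ = suc (commonPrefix xs ys)
... | no _ = 0

commonPrefix-comm : ∀ xs ys → commonPrefix xs ys ≡ commonPrefix ys xs
commonPrefix-comm [] [] = refl
commonPrefix-comm [] (_ ∷ _) = refl
commonPrefix-comm (_ ∷ _) [] = refl
commonPrefix-comm (x ∷ xs) (y ∷ ys) with x ≟ y | y ≟ x
... | yes _ | yes _ = cong suc (commonPrefix-comm xs ys)
... | no _ | no _ = refl
... | yes x≡y | no y≢x = ⊥-elim (y≢x (sym x≡y))
... | no x≢y | yes y≡x = ⊥-elim (x≢y (sym y≡x))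

commonPrefix-++ : ∀ A {s t} → HeadsDiffer s t → commonPrefix (A ++ s) (A ++ t) ≡ length A
commonPrefix-++ [] {x ∷ _} {y ∷ _} x≢y with x ≟ y
... | yes x≡y = ⊥-elim (x≢y x≡y)
... | no _ = refl
commonPrefix-++ (a ∷ A) d with a ≟ a
... | yes _ = cong suc (commonPrefix-++ A d)
... | no a≢a = ⊥-elim (a≢a refl)

commonSuffix : List ℕ → List ℕ → ℕ
commonSuffix xs ys = commonPrefix (reverse xs) (reverse ys)

commonSuffix-block : ∀ A X Y C → HeadsDiffer (reverse X) (reverse Y) →
  commonSuffix (A ++ X ++ C) (A ++ Y ++ C) ≡ length C
commonSuffix-block A X Y C d = begin
  commonPrefix (reverse (A ++ X ++ C)) (reverse (A ++ Y ++ C))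
    ≡⟨ cong₂ commonPrefix (reverse-block X) (reverse-block Y) ⟩
  commonPrefix (reverse C ++ reverse X ++ reverse A) (reverse C ++ reverse Y ++ reverse A)
    ≡⟨ commonPrefix-++ (reverse C) (HeadsDiffer-++ (reverse A) (reverse A) d) ⟩
  length (reverse C)
    ≡⟨ length-reverse C ⟩
  length C ∎
  where
    reverse-block : ∀ Z → reverse (A ++ Z ++ C) ≡ reverse C ++ reverse Z ++ reverse A
    reverse-block Z = begin
      reverse (A ++ Z ++ C)               ≡⟨ reverse-++ A (Z ++ C) ⟩
      reverse (Z ++ C) ++ reverse A       ≡⟨ cong (_++ reverse A) (reverse-++ Z C) ⟩
      (reverse C ++ reverse Z) ++ reverse A ≡⟨ ++-assoc (reverse C) (reverse Z) (reverse A) ⟩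
      reverse C ++ reverse Z ++ reverse A ∎

mtdrl-[] : ∀ {m} (b : Vec Bool m) → mtdrl {ℕ} b [] ≡ []
mtdrl-[] [] = refl
mtdrl-[] (_ ∷ _) = refl

mtdrl-false∷ : ∀ {m} (b : Vec Bool m) (x : ℕ) xs → mtdrl (false ∷ b) (x ∷ xs) ≡ mtdrl b xs ++ [ x ]
mtdrl-false∷ b x xs = begin
  ones b xs ++ reverse (x ∷ zeros b xs)        ≡⟨ cong (ones b xs ++_) (unfold-reverse x (zeros b xs)) ⟩
  ones b xs ++ (reverse (zeros b xs) ++ [ x ]) ≡⟨ ++-assoc (ones b xs) (reverse (zeros b xs)) [ x ] ⟨
  mtdrl b xs ++ [ x ]                          ∎

mtdrl-↭ : ∀ {m} (b : Vec Bool m) (xs : List ℕ) → length xs ≡ m → mtdrl b xs ↭ xs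
mtdrl-↭ [] [] refl = ↭-refl
mtdrl-↭ (true ∷ b) (x ∷ xs) refl = prep x (mtdrl-↭ b xs refl)
mtdrl-↭ (false ∷ b) (x ∷ xs) refl =
  subst (_↭ x ∷ xs) (sym (mtdrl-false∷ b x xs))
    (↭-trans (↭-sym (∷↭∷ʳ x (mtdrl b xs))) (prep x (mtdrl-↭ b xs refl)))

fixes-or-moves-last : ∀ {m} (b : Vec Bool m) (X : List ℕ) → Unique X → length X ≡ m →
  mtdrl b X ≡ X ⊎ HeadsDiffer (reverse X) (reverse (mtdrl b X))
fixes-or-moves-last [] [] _ refl = inj₁ refl
fixes-or-moves-last (true ∷ b) (x ∷ X) (_ ∷ X-unique) refl with fixes-or-moves-last b X X-unique refl
... | inj₁ fixed = inj₁ (cong (x ∷_) fixed)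
... | inj₂ d = inj₂ (subst₂ HeadsDiffer (sym (unfold-reverse x X)) (sym (unfold-reverse x (mtdrl b X)))
                       (HeadsDiffer-++ [ x ] [ x ] d))
fixes-or-moves-last (false ∷ []) (x ∷ []) _ refl = inj₁ refl
fixes-or-moves-last (false ∷ b) (x ∷ z ∷ Z) xzZ-unique refl =
  inj₂ (subst (HeadsDiffer (reverse (x ∷ z ∷ Z))) (sym x-first)
          (last≢first x z Z (reverse (mtdrl b (z ∷ Z))) xzZ-unique))
  where
    x-first : reverse (mtdrl (false ∷ b) (x ∷ z ∷ Z)) ≡ x ∷ reverse (mtdrl b (z ∷ Z))
    x-first = trans (cong reverse (mtdrl-false∷ b x (z ∷ Z))) (reverse-++ (mtdrl b (z ∷ Z)) [ x ])

led-by-last⇒reverse : ∀ {m} (Z : List ℕ) x R (b : Vec Bool m) → Unique (Z ++ [ x ]) → length (Z ++ [ x ]) ≡ m →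
  mtdrl b (Z ++ [ x ]) ≡ x ∷ R → mtdrl b (Z ++ [ x ]) ≡ reverse (Z ++ [ x ])
led-by-last⇒reverse [] x R (true ∷ []) _ refl _ = refl
led-by-last⇒reverse [] x R (false ∷ []) _ refl _ = refl
led-by-last⇒reverse (z ∷ Z) x R (true ∷ b) (z∉ ∷ _) refl z≡x∷ =
  ⊥-elim (All.lookup z∉ (∈-++⁺ʳ Z (here refl)) (∷-injectiveˡ z≡x∷))
led-by-last⇒reverse (z ∷ Z) x R (false ∷ b) (z∉ ∷ Zx-unique) refl led
  with head-of-snoc (mtdrl b (Z ++ [ x ])) (trans (sym (mtdrl-false∷ b z (Z ++ [ x ]))) led)
... | inj₁ z≡x = ⊥-elim (All.lookup z∉ (∈-++⁺ʳ Z (here refl)) z≡x)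
... | inj₂ (W , inner) = begin
  mtdrl (false ∷ b) (z ∷ Z ++ [ x ]) ≡⟨ mtdrl-false∷ b z (Z ++ [ x ]) ⟩
  mtdrl b (Z ++ [ x ]) ++ [ z ]      ≡⟨ cong (_++ [ z ]) (led-by-last⇒reverse Z x W b Zx-unique refl inner) ⟩
  reverse (Z ++ [ x ]) ++ [ z ]      ≡⟨ unfold-reverse z (Z ++ [ x ]) ⟨
  reverse (z ∷ Z ++ [ x ])           ∎

undone⇒suffixReversal : ∀ {m} (b b' : Vec Bool m) (X : List ℕ) → Unique X → length X ≡ m →
  mtdrl b' (mtdrl b X) ≡ X → ∃₂ λ P S → X ≡ P ++ S × mtdrl b X ≡ P ++ reverse S
undone⇒suffixReversal [] [] [] _ refl _ = [] , [] , refl , refl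
undone⇒suffixReversal (true ∷ b) (true ∷ b') (x ∷ X) (_ ∷ X-unique) refl undone
  with undone⇒suffixReversal b b' X X-unique refl (∷-injectiveʳ undone)
... | P , S , X≡ , Y≡ = x ∷ P , S , cong (x ∷_) X≡ , cong (x ∷_) Y≡
undone⇒suffixReversal (true ∷ b) (false ∷ b') (x ∷ X) (x∉ ∷ _) refl undone
  with snoc≡cons (mtdrl b' (mtdrl b X)) (trans (sym (mtdrl-false∷ b' x (mtdrl b X))) undone)
... | inj₁ refl = [ x ] , [] , refl , cong (x ∷_) (mtdrl-[] b)
... | inj₂ x∈X = ⊥-elim (All.lookup x∉ x∈X refl)
undone⇒suffixReversal (false ∷ b) b' (x ∷ X) xX-unique refl undone = [] , x ∷ X , refl , reversed
  where
    Y : List ℕ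
    Y = mtdrl b X ++ [ x ]
    Y-def : mtdrl (false ∷ b) (x ∷ X) ≡ Y
    Y-def = mtdrl-false∷ b x X
    Y↭ : Y ↭ x ∷ X
    Y↭ = subst (_↭ x ∷ X) Y-def (mtdrl-↭ (false ∷ b) (x ∷ X) refl)
    Y-undone : mtdrl b' Y ≡ x ∷ X
    Y-undone = trans (cong (mtdrl b') (sym Y-def)) undone
    Y-reversed : mtdrl b' Y ≡ reverse Y
    Y-reversed = led-by-last⇒reverse (mtdrl b X) x X b' (unique-↭ (↭-sym Y↭) xX-unique) (↭-length Y↭) Y-undone
    reversed : mtdrl (false ∷ b) (x ∷ X) ≡ reverse (x ∷ X)
    reversed = begin
      mtdrl (false ∷ b) (x ∷ X) ≡⟨ Y-def ⟩
      Y                         ≡⟨ reverse-involutive Y ⟨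
      reverse (reverse Y)       ≡⟨ cong reverse Y-reversed ⟨
      reverse (mtdrl b' Y)      ≡⟨ cong reverse Y-undone ⟩
      reverse (x ∷ X)           ∎

-- the selector of width k that keeps the first k ∸ t entries and reverses the last t:
-- an entry stays in front iff at least t entries follow it
suffixSel : (k t : ℕ) → Vec Bool k
suffixSel zero t = []
suffixSel (suc k) t = does (t ≤? k) ∷ suffixSel k t

suffixSel-reverses-all : ∀ k t (xs : List ℕ) → k ≤ t → length xs ≡ k → mtdrl (suffixSel k t) xs ≡ reverse xs
suffixSel-reverses-all zero t [] _ refl = refl
suffixSel-reverses-all (suc k) t (x ∷ xs) k<t refl rewrite dec-false (t ≤? k) (<⇒≱ k<t) = begin
  mtdrl (false ∷ suffixSel k t) (x ∷ xs) ≡⟨ mtdrl-false∷ (suffixSel k t) x xs ⟩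
  mtdrl (suffixSel k t) xs ++ [ x ]     ≡⟨ cong (_++ [ x ]) (suffixSel-reverses-all k t xs (≤-trans (n≤1+n k) k<t) refl) ⟩
  reverse xs ++ [ x ]                   ≡⟨ unfold-reverse x xs ⟨
  reverse (x ∷ xs)                      ∎

suffixSel-spec : ∀ k t (P S : List ℕ) → length S ≡ t → length P + t ≡ k →
  mtdrl (suffixSel k t) (P ++ S) ≡ P ++ reverse S
suffixSel-spec k t [] S refl refl = suffixSel-reverses-all k t S ≤-refl refl
suffixSel-spec zero t (p ∷ P) S _ ()
suffixSel-spec (suc k) t (p ∷ P) S |S| |P|+t
  rewrite dec-true (t ≤? k) (subst (t ≤_) (suc-injective |P|+t) (m≤n+m t (length P))) =
  cong (p ∷_) (suffixSel-spec k t P S |S| (suc-injective |P|+t))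

length-front : ∀ {k} t (X : List ℕ) → length X ≡ k → length (take (k ∸ t) X) ≡ k ∸ t
length-front {k} t X refl = trans (length-take (k ∸ t) X) (m≤n⇒m⊓n≡m (m∸n≤m k t))

length-back : ∀ {k t} (X : List ℕ) → t ≤ k → length X ≡ k → length (drop (k ∸ t) X) ≡ t
length-back {k} {t} X t≤k refl = trans (length-drop (k ∸ t) X) (m∸[m∸n]≡n t≤k)

length-front+back : ∀ {k t} (X : List ℕ) → t ≤ k → length X ≡ k → length (take (k ∸ t) X) + t ≡ k
length-front+back {t = t} X t≤k |X| = trans (cong (_+ t) (length-front t X |X|)) (m∸n+n≡m t≤k)

suffixSel-window : ∀ {k t} (X : List ℕ) → t ≤ k → length X ≡ k →
  mtdrl (suffixSel k t) X ≡ take (k ∸ t) X ++ reverse (drop (k ∸ t) X)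
suffixSel-window {k} {t} X t≤k |X| = begin
  mtdrl (suffixSel k t) X
    ≡⟨ cong (mtdrl (suffixSel k t)) (take++drop≡id (k ∸ t) X) ⟨
  mtdrl (suffixSel k t) (take (k ∸ t) X ++ drop (k ∸ t) X)
    ≡⟨ suffixSel-spec k t (take (k ∸ t) X) (drop (k ∸ t) X) (length-back X t≤k |X|) (length-front+back X t≤k |X|) ⟩
  take (k ∸ t) X ++ reverse (drop (k ∸ t) X) ∎

suffixSel-identity : ∀ {k} (X : List ℕ) → length X ≡ k → mtdrl (suffixSel k 0) X ≡ X
suffixSel-identity {k} X |X| = begin
  mtdrl (suffixSel k 0) X        ≡⟨ cong (mtdrl (suffixSel k 0)) (++-identityʳ X) ⟨
  mtdrl (suffixSel k 0) (X ++ []) ≡⟨ suffixSel-spec k 0 X [] refl (trans (+-identityʳ (length X)) |X|) ⟩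
  X ++ []                        ≡⟨ ++-identityʳ X ⟩
  X                              ∎

suffixSel-involutive : ∀ {k t} (X : List ℕ) → t ≤ k → length X ≡ k →
  mtdrl (suffixSel k t) (mtdrl (suffixSel k t) X) ≡ X
suffixSel-involutive {k} {t} X t≤k |X| = begin
  mtdrl (suffixSel k t) (mtdrl (suffixSel k t) X)
    ≡⟨ cong (mtdrl (suffixSel k t)) (suffixSel-window X t≤k |X|) ⟩
  mtdrl (suffixSel k t) (P ++ reverse S)
    ≡⟨ suffixSel-spec k t P (reverse S) (trans (length-reverse S) (length-back X t≤k |X|)) (length-front+back X t≤k |X|) ⟩
  P ++ reverse (reverse S)
    ≡⟨ cong (P ++_) (reverse-involutive S) ⟩
  P ++ S
    ≡⟨ take++drop≡id (k ∸ t) X ⟩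
  X ∎
  where
    P = take (k ∸ t) X
    S = drop (k ∸ t) X

module ProperSuffixReversal {k t : ℕ} (2≤t : 2 ≤ t) (t≤k : t ≤ k) {X : List ℕ}
                            (X-unique : Unique X) (|X| : length X ≡ k) where

  private
    P S : List ℕ
    P = take (k ∸ t) X
    S = drop (k ∸ t) X

    X-split : X ≡ P ++ S
    X-split = sym (take++drop≡id (k ∸ t) X)

    S-ends-differ : HeadsDiffer (reverse S) S
    S-ends-differ = ends-differ S (UniqueP.drop⁺ (k ∸ t) X-unique)
                      (subst (2 ≤_) (sym (length-back X t≤k |X|)) 2≤t)

  moves-last : HeadsDiffer (reverse X) (reverse (mtdrl (suffixSel k t) X))
  moves-last = subst₂ HeadsDiffer (cong reverse (sym X-split)) (cong reverse (sym (suffixSel-window X t≤k |X|)))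
    (subst₂ HeadsDiffer (sym (reverse-++ P S)) reversed-twice (HeadsDiffer-++ (reverse P) (reverse P) S-ends-differ))
    where
      reversed-twice : S ++ reverse P ≡ reverse (P ++ reverse S)
      reversed-twice = begin
        S ++ reverse P                   ≡⟨ cong (_++ reverse P) (reverse-involutive S) ⟨
        reverse (reverse S) ++ reverse P ≡⟨ reverse-++ P (reverse S) ⟨
        reverse (P ++ reverse S)         ∎

  first-change : commonPrefix X (mtdrl (suffixSel k t) X) ≡ k ∸ t
  first-change = begin
    commonPrefix X (mtdrl (suffixSel k t) X)
      ≡⟨ cong₂ commonPrefix X-split (suffixSel-window X t≤k |X|) ⟩
    commonPrefix (P ++ S) (P ++ reverse S)
      ≡⟨ commonPrefix-++ P (HeadsDiffer-sym S-ends-differ) ⟩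
    length P
      ≡⟨ length-front t X |X| ⟩
    k ∸ t ∎

-- Windows of width k in a list, described by take and drop; bounded operations
-- of width k at position a + 1 act on the window after the first a entries.
module Windows (k : ℕ) where

  before window after : ℕ → List ℕ → List ℕ
  before a ρ = take a ρ
  window a ρ = take k (drop a ρ)
  after a ρ = drop (a + k) ρ

  window-split : ∀ a ρ → ρ ≡ before a ρ ++ window a ρ ++ after a ρ
  window-split a ρ = sym (begin
    take a ρ ++ take k (drop a ρ) ++ drop (a + k) ρ
      ≡⟨ cong (λ σ → take a ρ ++ take k (drop a ρ) ++ σ) (drop-drop a k ρ) ⟨
    take a ρ ++ take k (drop a ρ) ++ drop k (drop a ρ)
      ≡⟨ cong (take a ρ ++_) (take++drop≡id k (drop a ρ)) ⟩
    take a ρ ++ drop a ρ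
      ≡⟨ take++drop≡id a ρ ⟩
    ρ ∎)

  window-unique : ∀ a {ρ} → Unique ρ → Unique (window a ρ)
  window-unique a ρ-unique = UniqueP.take⁺ k (UniqueP.drop⁺ a ρ-unique)

  module _ {n a : ℕ} {ρ : List ℕ} (|ρ| : length ρ ≡ n) (fits : a + k ≤ n) where

    length-before : length (before a ρ) ≡ a
    length-before = trans (length-take a ρ)
      (trans (cong (a ⊓_) |ρ|) (m≤n⇒m⊓n≡m (≤-trans (m≤m+n a k) fits)))

    length-window : length (window a ρ) ≡ k
    length-window = trans (length-take k (drop a ρ))
      (trans (cong (k ⊓_) (trans (length-drop a ρ) (cong (_∸ a) |ρ|)))
        (m≤n⇒m⊓n≡m (subst (_≤ n ∸ a) (m+n∸m≡n a k) (∸-monoˡ-≤ a fits))))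

  length-after : ∀ {n} a {ρ : List ℕ} → length ρ ≡ n → length (after a ρ) ≡ n ∸ (a + k)
  length-after a {ρ} |ρ| = trans (length-drop (a + k) ρ) (cong (_∸ (a + k)) |ρ|)

  window-restored : ∀ a ρ {Y} → Y ≡ window a ρ → before a ρ ++ Y ++ after a ρ ≡ ρ
  window-restored a ρ Y≡ =
    trans (cong (λ Y → before a ρ ++ Y ++ after a ρ) Y≡) (sym (window-split a ρ))

  window-changed : ∀ a (b : Vec Bool k) ρ →
    HeadsDiffer (reverse (window a ρ)) (reverse (mtdrl b (window a ρ))) →
    commonSuffix ρ (boundedMTDRL (suc a) b ρ) ≡ length (after a ρ)
  window-changed a b ρ d = begin
    commonSuffix ρ (boundedMTDRL (suc a) b ρ)
      ≡⟨ cong (λ σ → commonSuffix σ (boundedMTDRL (suc a) b ρ)) (window-split a ρ) ⟩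
    commonSuffix (before a ρ ++ window a ρ ++ after a ρ) (before a ρ ++ mtdrl b (window a ρ) ++ after a ρ)
      ≡⟨ commonSuffix-block (before a ρ) (window a ρ) (mtdrl b (window a ρ)) (after a ρ) d ⟩
    length (after a ρ) ∎

  window-↭ : ∀ a (b : Vec Bool k) ρ → length (window a ρ) ≡ k → boundedMTDRL (suc a) b ρ ↭ ρ
  window-↭ a b ρ |X| = subst (boundedMTDRL (suc a) b ρ ↭_) (sym (window-split a ρ))
    (++⁺ˡ (before a ρ) (++⁺ʳ (after a ρ) (mtdrl-↭ b (window a ρ) |X|)))

  boundedMTDRL-block : ∀ (b : Vec Bool k) (A Y C : List ℕ) → length Y ≡ k →
    boundedMTDRL (suc (length A)) b (A ++ Y ++ C) ≡ A ++ mtdrl b Y ++ C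
  boundedMTDRL-block b A Y C refl = cong₂ _++_ (take-length-++ A (Y ++ C))
    (cong₂ _++_ (cong (mtdrl b) (trans (cong (take (length Y)) (drop-length-++ A (Y ++ C))) (take-length-++ Y C)))
      (begin
        drop (length A + length Y) (A ++ Y ++ C)  ≡⟨ drop-drop (length A) (length Y) (A ++ Y ++ C) ⟨
        drop (length Y) (drop (length A) (A ++ Y ++ C)) ≡⟨ cong (drop (length Y)) (drop-length-++ A (Y ++ C)) ⟩
        drop (length Y) (Y ++ C)                  ≡⟨ drop-length-++ Y C ⟩
        C                                         ∎))

  window-twice : ∀ {n a} (b b' : Vec Bool k) ρ → length ρ ≡ n → a + k ≤ n →
    boundedMTDRL (suc a) b' (boundedMTDRL (suc a) b ρ)
      ≡ before a ρ ++ mtdrl b' (mtdrl b (window a ρ)) ++ after a ρ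
  window-twice {a = a} b b' ρ |ρ| fits =
    subst (λ a' → boundedMTDRL (suc a') b' (boundedMTDRL (suc a) b ρ)
                    ≡ before a ρ ++ mtdrl b' (mtdrl b (window a ρ)) ++ after a ρ)
      (length-before |ρ| fits)
      (boundedMTDRL-block b' (before a ρ) (mtdrl b (window a ρ)) (after a ρ)
        (trans (↭-length (mtdrl-↭ b (window a ρ) (length-window |ρ| fits))) (length-window |ρ| fits)))

window-fits : ∀ {n k a} → k ≤ n → a < n ∸ k + 1 → a + k ≤ n
window-fits {n} {k} {a} k≤n a< =
  m≤o∸n⇒m+n≤o a k≤n (s≤s⁻¹ (subst (suc a ≤_) (+-comm (n ∸ k) 1) a<))

s<k∸1⇒2+s≤k : ∀ {s} k → s < k ∸ 1 → 2 + s ≤ k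
s<k∸1⇒2+s≤k (suc k) s<k = s≤s s<k

2+s≤k⇒s<k∸1 : ∀ {s k} → 2 + s ≤ k → s < k ∸ 1
2+s≤k⇒s<k∸1 (s≤s 1+s≤k) = 1+s≤k

module Counting (n k : ℕ) (k≤n : k ≤ n) (π : List ℕ) (π-perm : IsPerm n π) where

  open Windows k

  π-length : length π ≡ n
  π-length = IsPerm⇒length π-perm

  -- (a , s) stands for reversing the last 2 + s entries of the window after a entries
  indices : List (ℕ × ℕ)
  indices = cartesianProduct (upTo (n ∸ k + 1)) (upTo (k ∸ 1))

  index-range : ∀ {a s} → (a , s) ∈ indices → a < n ∸ k + 1 × s < k ∸ 1
  index-range as∈ with a∈ , s∈ ← ∈-cartesianProduct⁻ (upTo (n ∸ k + 1)) (upTo (k ∸ 1)) as∈ =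
    ∈-upTo⁻ a∈ , ∈-upTo⁻ s∈

  reversal : ℕ × ℕ → List ℕ
  reversal (a , s) = boundedMTDRL (suc a) (suffixSel k (2 + s)) π

  candidates : List (List ℕ)
  candidates = π ∷ map reversal indices

  same-window : ∀ {a a'} ρ σ → a < n ∸ k + 1 → a' < n ∸ k + 1 →
    commonSuffix ρ σ ≡ n ∸ (a + k) → commonSuffix ρ σ ≡ n ∸ (a' + k) → a ≡ a'
  same-window _ _ a< a'< at-a at-a' = +-cancelʳ-≡ k _ _
    (∸-cancelˡ-≡ (window-fits k≤n a<) (window-fits k≤n a'<) (trans (sym at-a) at-a'))

  fixes-or-changes-at : ∀ {a} ρ (b : Vec Bool k) → IsPerm n ρ → a < n ∸ k + 1 →
    boundedMTDRL (suc a) b ρ ≡ ρ ⊎ commonSuffix ρ (boundedMTDRL (suc a) b ρ) ≡ n ∸ (a + k)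
  fixes-or-changes-at {a} ρ b ρ-perm a<
    with fixes-or-moves-last b (window a ρ) (window-unique a (IsPerm⇒Unique ρ-perm))
           (length-window (IsPerm⇒length ρ-perm) (window-fits k≤n a<))
  ... | inj₁ fixed = inj₁ (window-restored a ρ fixed)
  ... | inj₂ d = inj₂ (trans (window-changed a b ρ d) (length-after a (IsPerm⇒length ρ-perm)))

  module Reversal {a s : ℕ} (a< : a < n ∸ k + 1) (s< : s < k ∸ 1) =
    ProperSuffixReversal (s≤s (s≤s (z≤n {s}))) (s<k∸1⇒2+s≤k k s<)
      (window-unique a (IsPerm⇒Unique π-perm)) (length-window π-length (window-fits k≤n a<))

  reversal-position : ∀ {a s} → a < n ∸ k + 1 → s < k ∸ 1 →
    commonSuffix π (reversal (a , s)) ≡ n ∸ (a + k)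
  reversal-position {a} {s} a< s< =
    trans (window-changed a (suffixSel k (2 + s)) π (Reversal.moves-last a< s<)) (length-after a π-length)

  -- suffix reversals change π, and different indices give different permutations:
  -- the common suffix with π determines the window, the common prefix inside the
  -- window determines the suffix length
  reversal≢π : ∀ {a s} → a < n ∸ k + 1 → s < k ∸ 1 → π ≢ reversal (a , s)
  reversal≢π {a} {s} a< s< π≡ =
    HeadsDiffer⇒≢ (Reversal.moves-last a< s<)
      (cong reverse (++-cancel-middle (before a π) _ _ (after a π) (trans (sym (window-split a π)) π≡)))

  reversal-injective : ∀ {a s a' s'} → a < n ∸ k + 1 → s < k ∸ 1 → a' < n ∸ k + 1 → s' < k ∸ 1 →
    reversal (a , s) ≡ reversal (a' , s') → (a , s) ≡ (a' , s')
  reversal-injective {a} {s} {a'} {s'} a< s< a'< s'< same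
    with refl ← same-window π (reversal (a , s)) a< a'< (reversal-position a< s<)
                  (trans (cong (commonSuffix π) same) (reversal-position a'< s'<)) =
    cong (a ,_) (+-cancelˡ-≡ 2 s s' (∸-cancelˡ-≡ (s<k∸1⇒2+s≤k k s<) (s<k∸1⇒2+s≤k k s'<) (begin
      k ∸ (2 + s)                                       ≡⟨ Reversal.first-change a< s< ⟨
      commonPrefix X (mtdrl (suffixSel k (2 + s)) X)    ≡⟨ cong (commonPrefix X) same-contents ⟩
      commonPrefix X (mtdrl (suffixSel k (2 + s')) X)   ≡⟨ Reversal.first-change a< s'< ⟩
      k ∸ (2 + s')                                      ∎)))
    where
      X = window a π
      same-contents : mtdrl (suffixSel k (2 + s)) X ≡ mtdrl (suffixSel k (2 + s')) X
      same-contents = ++-cancel-middle (before a π) _ _ (after a π) same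

  π-in-both : Sout n k π π × Sin n k π π
  π-in-both = stay , π-perm , stay
    where
      stay : Sout n k π π
      stay = 1 , s≤s z≤n , m≤n+m 1 (n ∸ k) , suffixSel k 0 ,
             sym (window-restored 0 π
                    (suffixSel-identity (window 0 π) (length-window π-length k≤n)))

  reversal-in-both : ∀ {a s} → a < n ∸ k + 1 → s < k ∸ 1 →
    Sout n k π (reversal (a , s)) × Sin n k π (reversal (a , s))
  reversal-in-both {a} {s} a< s< =
    (suc a , s≤s z≤n , a< , sel , refl) ,
    ↭-trans (window-↭ a sel π |X|) π-perm ,
    (suc a , s≤s z≤n , a< , sel , sym undone)
    where
      sel = suffixSel k (2 + s)
      |X| = length-window π-length (window-fits k≤n a<)
      undone : boundedMTDRL (suc a) sel (reversal (a , s)) ≡ π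
      undone = begin
        boundedMTDRL (suc a) sel (reversal (a , s))
          ≡⟨ window-twice sel sel π π-length (window-fits k≤n a<) ⟩
        before a π ++ mtdrl sel (mtdrl sel (window a π)) ++ after a π
          ≡⟨ window-restored a π (suffixSel-involutive (window a π) (s<k∸1⇒2+s≤k k s<) |X|) ⟩
        π ∎

  sound : ∀ ρ → ρ ∈ candidates → Sout n k π ρ × Sin n k π ρ
  sound ρ (here refl) = π-in-both
  sound ρ (there ρ∈) with (a , s) , as∈ , refl ← ∈-map⁻ reversal ρ∈ =
    reversal-in-both (proj₁ (index-range as∈)) (proj₂ (index-range as∈))

  suffixReversal∈candidates : ∀ {a} (b : Vec Bool k) → a < n ∸ k + 1 → ∀ P S →
    window a π ≡ P ++ S → mtdrl b (window a π) ≡ P ++ reverse S →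
    boundedMTDRL (suc a) b π ∈ candidates
  suffixReversal∈candidates {a} b a< P [] X≡ Y≡ = here (window-restored a π (trans Y≡ (sym X≡)))
  suffixReversal∈candidates {a} b a< P (_ ∷ []) X≡ Y≡ = here (window-restored a π (trans Y≡ (sym X≡)))
  suffixReversal∈candidates {a} b a< P S@(_ ∷ _ ∷ Z) X≡ Y≡ =
    there (subst (_∈ map reversal indices) (sym is-reversal)
            (∈-map⁺ reversal (∈-cartesianProduct⁺ (∈-upTo⁺ a<) (∈-upTo⁺ (2+s≤k⇒s<k∸1 2+s≤k)))))
    where
      |P|+|S| : length P + length S ≡ k
      |P|+|S| = trans (sym (length-++ P)) (trans (cong length (sym X≡))
                  (length-window π-length (window-fits k≤n a<)))
      2+s≤k : 2 + length Z ≤ k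
      2+s≤k = subst (length S ≤_) |P|+|S| (m≤n+m (length S) (length P))
      is-reversal : boundedMTDRL (suc a) b π ≡ reversal (a , length Z)
      is-reversal = cong (λ Y → before a π ++ Y ++ after a π) (begin
        mtdrl b (window a π)                   ≡⟨ Y≡ ⟩
        P ++ reverse S                         ≡⟨ suffixSel-spec k (length S) P S refl |P|+|S| ⟨
        mtdrl (suffixSel k (length S)) (P ++ S) ≡⟨ cong (mtdrl (suffixSel k (length S))) X≡ ⟨
        mtdrl (suffixSel k (length S)) (window a π) ∎)

  round-trip : ∀ {a} (b b' : Vec Bool k) → a < n ∸ k + 1 →
    boundedMTDRL (suc a) b' (boundedMTDRL (suc a) b π) ≡ π → boundedMTDRL (suc a) b π ∈ candidates
  round-trip {a} b b' a< back =
    let P , S , X≡ , Y≡ = undone⇒suffixReversal b b' (window a π) (window-unique a (IsPerm⇒Unique π-perm))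
                            (length-window π-length (window-fits k≤n a<)) window-undone
    in suffixReversal∈candidates b a< P S X≡ Y≡
    where
      window-undone : mtdrl b' (mtdrl b (window a π)) ≡ window a π
      window-undone = ++-cancel-middle (before a π) _ _ (after a π)
        (trans (sym (window-twice b b' π π-length (window-fits k≤n a<))) (trans back (window-split a π)))

  -- completeness: a round trip π → ρ → π uses one window twice, unless ρ = π
  complete : ∀ ρ → Sout n k π ρ × Sin n k π ρ → ρ ∈ candidates
  complete ρ ((suc a , s≤s z≤n , a< , b , refl) , ρ-perm , (suc a' , s≤s z≤n , a'< , b' , back))
    with fixes-or-changes-at π b π-perm a< | fixes-or-changes-at ρ b' ρ-perm a'<
  ... | inj₁ fixed | _ = here fixed
  ... | inj₂ _ | inj₁ fixed = here (sym (trans back fixed))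
  ... | inj₂ at-a | inj₂ at-a'
    with refl ← same-window π ρ a< a'< at-a
                  (trans (commonPrefix-comm (reverse π) (reverse ρ)) (trans (cong (commonSuffix ρ) back) at-a')) =
    round-trip b b' a< (sym back)

  candidates-unique : Unique candidates
  candidates-unique =
    AllP.map⁺ (All.tabulate λ {(a , s)} as∈ → reversal≢π (proj₁ (index-range as∈)) (proj₂ (index-range as∈)))
    ∷ map-Unique-on reversal
        (λ as∈ as'∈ → reversal-injective (proj₁ (index-range as∈)) (proj₂ (index-range as∈))
                                          (proj₁ (index-range as'∈)) (proj₂ (index-range as'∈)))
        (UniqueP.cartesianProduct⁺ (UniqueP.upTo⁺ (n ∸ k + 1)) (UniqueP.upTo⁺ (k ∸ 1)))

  candidates-length : length candidates ≡ (n ∸ k + 1) * (k ∸ 1) + 1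
  candidates-length = begin
    suc (length (map reversal indices)) ≡⟨ cong suc (length-map reversal indices) ⟩
    suc (length indices)               ≡⟨ cong suc (length-cartesianProduct (upTo (n ∸ k + 1)) (upTo (k ∸ 1))) ⟩
    suc (length (upTo (n ∸ k + 1)) * length (upTo (k ∸ 1)))
                                       ≡⟨ cong suc (cong₂ _*_ (length-upTo (n ∸ k + 1)) (length-upTo (k ∸ 1))) ⟩
    suc ((n ∸ k + 1) * (k ∸ 1))        ≡⟨ +-comm 1 ((n ∸ k + 1) * (k ∸ 1)) ⟩
    (n ∸ k + 1) * (k ∸ 1) + 1          ∎

-- Theorem 10: |S_out(π;k) ∩ S_in(π;k)| = (n ∸ k + 1)(k ∸ 1) + 1; the count also
-- holds for k = 0.
theorem10 : (n k : ℕ) → 1 ≤ k → k ≤ n → (π : List ℕ) → IsPerm n π →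
    HasCard (λ ρ → Sout n k π ρ × Sin n k π ρ) ((n ∸ k + 1) * (k ∸ 1) + 1)
theorem10 n k _ k≤n π π-perm =
  candidates , candidates-unique ,
  (λ ρ → mk⇔ (sound ρ) (complete ρ)) ,
  candidates-length
  where open Counting n k k≤n π π-perm
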